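{- Let $d\ge1$ and let $f\in\mathbb{F}_{\bar{A},C}[x_1,\ldots,x_n]$ be a homogeneous polynomial of degree $d'$ with $1\le d'\le d$. Then the $(1,d'+1,1)$-th entry of $\Phi(f)\in\mathbb{C}'_d$ is equal to $\phi(f_{d'})$, where $f_{d'}$ is the homogeneous degree-$d'$ component of $f$.
   Context: $\mathbb{F}_{\bar{A},C}[X]$ is the commutative, nonassociative polynomial algebra over $\mathbb{F}$: basis the monomial $1$ and rooted full binary trees whose leaves are labeled by variables from $X=\{x_1,\ldots,x_n\}$, identified up to swapping children at internal nodes; product of monomials $m_1,m_2$ = tree with root subtrees $m_1,m_2$; degree = number of leaves; $f$ is homogeneous of degree $d'$ if all its monomials have degree $d'$. Let $Z=\{z_{i,j,k}: i\in[n], j,k\in[d]\}$ be commuting variables and $\mathbb{F}(Z)$ the rational function field. Let $\mathbb{A}'_d=\mathbb{F}(Z)^{d(d+1)^2}$ with entries indexed $x[i,j,k]$, $1\le i,j\le d+1$, $1\le k\le d$, and product $z=x\circ y$ with $z[i,j,d]=0$, $z[i,j,k]=\sum_{l=1}^{d+1}x[i,l,k+1]y[l,j,k+1]$ for $1\le k\le d-1$. $\mathbb{C}'_d$ is the same vector space with product $a\odot b=a\circ b+b\circ a$. Let $Z_i\in\mathbb{C}'_d$ have $(j,j+1,k)$-th entry $z_{i,j,k}$ for all $j,k\in[d]$ and all other entries $0$. $\Phi$ is the linear map sending each monomial of degree $\ge1$ to its evaluation at $x_i\mapsto Z_i$ (products computed with $\odot$). For a monomial $m$ of degree $d'\ge1$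 (a tree), an orientation $o$ of $m$ is a choice, at each internal node, of which child is the left one; there are $2^{d'-1}$ orientations. An orientation determines a left-to-right order of the leaves; let $\sigma_o(t)$ be the index $i$ of the variable $x_i$ labeling the $t$-th leaf and $l^{o}_t$ its level, where the level of a node is $1+$ its distance from the root. Define $\phi(m)=\sum_{o}\prod_{t=1}^{d'}z_{\sigma_o(t),t,l^o_t}\in\mathbb{F}[Z]$, the sum over all orientations $o$ of $m$, and extend $\phi$ linearly. -}

module Defs where

open import Level using (Level; _⊔_)
open import Data.Nat using (ℕ; zero; suc; _≤_; _<_) renaming (_+_ to _+ℕ_)
open import Data.Fin using (Fin; zero; suc; inject₁; toℕ) renaming (_≟_ to _≟ᶠ_)
open import Data.Maybe using (Maybe; just; nothing)
import Data.Maybe as Maybe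
open import Data.List using (List; []; _∷_; _++_; filter; concatMap; map)
open import Data.Product using (Σ; _×_; _,_; proj₁; proj₂)
open import Relation.Nullary using (¬_; yes; no)
open import Relation.Binary.PropositionalEquality using (_≡_)
open import Data.List.Relation.Unary.All using (All)
open import Data.Nat using () renaming (_≟_ to _ℕ≟_; _<?_ to _ℕ<?_)
open import Data.Fin using (fromℕ<)
open import Algebra.Bundles using (CommutativeRing)

record IsField {c ℓ} (F : CommutativeRing c ℓ) : Set (c ⊔ ℓ) where
  open CommutativeRing F
  field
    1≉0 : ¬ (1# ≈ 0#)
    inverse : ∀ x → ¬ (x ≈ 0#) → Σ Carrier (λ y → x * y ≈ 1#)

-- Monomials of the commutative nonassociative polynomial algebra in
-- variables x_0 … x_{n-1}: the monomial 1, or a rooted full binary tree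
-- with leaves labelled by variables.  Trees are NOT quotiented by the
-- swap of children; every function below is invariant under swapping,
-- so this is harmless.

data Tree (n : ℕ) : Set where
  leaf : Fin n → Tree n
  node : Tree n → Tree n → Tree n

data Mono (n : ℕ) : Set where
  𝟙   : Mono n
  ⌜_⌝ : Tree n → Mono n

leaves : ∀ {n} → Tree n → ℕ
leaves (leaf _)   = 1
leaves (node t u) = leaves t +ℕ leaves u

deg : ∀ {n} → Mono n → ℕ
deg 𝟙     = 0
deg ⌜ t ⌝ = leaves t

Poly : ∀ {a} → Set a → ℕ → Set a
Poly A n = List (A × Mono n)

IsHomogeneous : ∀ {a} {A : Set a} {n} → ℕ → Poly A n → Set a
IsHomogeneous d' f = All (λ term → deg (proj₂ term) ≡ d') f

component : ∀ {a} {A : Set a} {n} → ℕ → Poly A n → Poly A n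
component d' f = filter (λ term → deg (proj₂ term) ℕ≟ d') f

next : ∀ {m} → Fin m → Maybe (Fin m)
next {suc zero}    zero    = nothing
next {suc (suc m)} zero    = just (suc zero)
next {suc m}       (suc k) = Maybe.map suc (next k)

-- Constructions over a commutative ring K (playing the role of F(Z)),
-- n variables, parameter d, and values z i j k ∈ K for the z_{i,j,k}
-- (indices 0-based: z i j k stands for z_{i+1,j+1,k+1}).

module Construction {c ℓ} (K : CommutativeRing c ℓ) (n d : ℕ)
                    (z : Fin n → Fin d → Fin d → K .CommutativeRing.Carrier) where
  open CommutativeRing K using (Carrier; _+_; _*_; 0#; 1#)

  Σᶠ : ∀ {m} → (Fin m → Carrier) → Carrier
  Σᶠ {zero}  g = 0#
  Σᶠ {suc m} g = g zero + Σᶠ (λ i → g (suc i))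

  sumL : List Carrier → Carrier
  sumL []       = 0#
  sumL (x ∷ xs) = x + sumL xs

  prodL : List Carrier → Carrier
  prodL []       = 1#
  prodL (x ∷ xs) = x * prodL xs

  -- The vector space F(Z)^{d(d+1)^2}: entry x[i,j,k] is  x i j k  with
  -- 0-based i j : Fin (d+1), k : Fin d.
  Elt : Set c
  Elt = Fin (suc d) → Fin (suc d) → Fin d → Carrier

  zeroElt : Elt
  zeroElt _ _ _ = 0#

  _+ᴱ_ : Elt → Elt → Elt
  (x +ᴱ y) i j k = x i j k + y i j k

  _•ᴱ_ : Carrier → Elt → Elt
  (a •ᴱ x) i j k = a * x i j k

  _∘ᴬ_ : Elt → Elt → Elt
  (x ∘ᴬ y) i j k with next k
  ... | nothing = 0#
  ... | just k′ = Σᶠ (λ l → x i l k′ * y l j k′)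

  _⊙_ : Elt → Elt → Elt
  a ⊙ b = (a ∘ᴬ b) +ᴱ (b ∘ᴬ a)

  Zᵢ : Fin n → Elt
  Zᵢ i a zero    k = 0#
  Zᵢ i a (suc j) k with a ≟ᶠ inject₁ j
  ... | yes _ = z i j k
  ... | no  _ = 0#

  -- Φ on monomials (Φ(1) := 0 by convention; never used for degree ≥ 1)
  Φtree : Tree n → Elt
  Φtree (leaf i)   = Zᵢ i
  Φtree (node t u) = Φtree t ⊙ Φtree u

  Φmono : Mono n → Elt
  Φmono 𝟙     = zeroElt
  Φmono ⌜ t ⌝ = Φtree t

  -- z_{i,t,l} with 1-based ℕ indices t, l (0 if out of range; this never
  -- happens for monomials of degree ≤ d)
  zℕ : Fin n → ℕ → ℕ → Carrier
  zℕ i zero     l        = 0#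
  zℕ i (suc t′) zero     = 0#
  zℕ i (suc t′) (suc l′) with t′ ℕ<? d | l′ ℕ<? d
  ... | yes p | yes q = z i (fromℕ< p) (fromℕ< q)
  ... | _     | _     = 0#

  -- All orientations of a tree whose root is at level l: each orientation
  -- gives the left-to-right list of (leaf variable, leaf level).
  orientations : Tree n → ℕ → List (List (Fin n × ℕ))
  orientations (leaf i)   l = (( i , l ) ∷ []) ∷ []
  orientations (node t u) l =
    concatMap (λ o₁ → concatMap (λ o₂ → (o₁ ++ o₂) ∷ (o₂ ++ o₁) ∷ [])
                                (orientations u (suc l)))
              (orientations t (suc l))

  weight : ℕ → List (Fin n × ℕ) → List Carrier
  weight t []              = []
  weight t ((i , l) ∷ rest) = zℕ i t l ∷ weight (suc t) rest

  φtree : Tree n → Carrier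
  φtree t = sumL (map (λ o → prodL (weight 1 o)) (orientations t 1))

  φmono : Mono n → Carrier
  φmono 𝟙     = 1#
  φmono ⌜ t ⌝ = φtree t

  module _ {a} {A : Set a} (ι : A → Carrier) where
    Φ : Poly A n → Elt
    Φ []             = zeroElt
    Φ ((c , m) ∷ f) = (ι c •ᴱ Φmono m) +ᴱ Φ f

    φ : Poly A n → Carrier
    φ []             = 0#
    φ ((c , m) ∷ f) = ι c * φmono m + φ f

{-# OPTIONS --safe #-}
-- Every Zᵢ lives on the first superdiagonal and ∘ᴬ adds band offsets, so the entry (a, b, k) of
-- Φ(t) vanishes unless b = a + |t|.  On that band the sum over the middle index in Φ(t) ⊙ Φ(u)
-- collapses to the single index a + |t| (resp. a + |u|), so the band entries obey the recursion
-- of the orientation sums: an orientation of node t u lists the leaves of one child and then those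
-- of the other, shifted by the size of the first, one level deeper.  At the last level both sides
-- vanish.  Linearity and f = f_{d'} then give the theorem.
module Submission where

open import Defs
open import Level using (Level)
open import Data.Nat using (ℕ; suc; _≤_; s≤s)
open import Data.Fin using (Fin; zero; fromℕ<)
open import Algebra.Bundles using (CommutativeRing)
open import Algebra.Morphism.Structures using (IsRingHomomorphism)

open import Data.Nat.Base as ℕ using (_<_)
import Data.Nat.Properties as ℕ
open import Data.Fin.Base using (suc; toℕ; inject₁)
open import Data.Fin.Properties
  using (_≟_; toℕ<n; toℕ-injective; toℕ-fromℕ<; fromℕ<-toℕ; toℕ-inject₁; suc-injective)
open import Data.List.Base using (List; []; _∷_; _++_; map; concatMap; length)
open import Data.List.Properties using (length-++; filter-all)
open import Data.List.Relation.Unary.All as All using (All; []; _∷_)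
open import Data.List.Relation.Unary.All.Properties using (concat⁺; map⁺)
open import Data.Maybe.Base using (just; nothing)
open import Data.Product.Base using (_×_; _,_; proj₂)
open import Data.Empty using (⊥-elim)
open import Function.Base using (_∘_)
open import Relation.Nullary.Decidable using (yes; no)
open import Relation.Binary.PropositionalEquality as ≡ using (_≡_; _≢_)

toℕ-next : ∀ {m} {k k′ : Fin m} → next k ≡ just k′ → toℕ k′ ≡ suc (toℕ k)
toℕ-next {suc ℕ.zero} {zero}  ()
toℕ-next {suc (suc m)} {zero}  ≡.refl = ≡.refl
toℕ-next {suc (suc m)} {suc k} eq with next k in eq′
toℕ-next {suc (suc m)} {suc k} ≡.refl | just _ = ≡.cong suc (toℕ-next eq′)

next≡nothing⇒last : ∀ {m} {k : Fin m} → next k ≡ nothing → suc (toℕ k) ≡ m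
next≡nothing⇒last {suc ℕ.zero} {zero}  ≡.refl = ≡.refl
next≡nothing⇒last {suc (suc m)} {suc k} eq with next k in eq′
next≡nothing⇒last {suc (suc m)} {suc k} ≡.refl | nothing = ≡.cong suc (next≡nothing⇒last eq′)

module Entries {r ℓ} (K : CommutativeRing r ℓ) (n d : ℕ)
               (z : Fin n → Fin d → Fin d → CommutativeRing.Carrier K) where
  open Construction K n d z
  open CommutativeRing K hiding (zero)
  open import Relation.Binary.Reasoning.Setoid setoid
  open import Algebra.Properties.CommutativeSemigroup +-commutativeSemigroup using (interchange)

  private variable
    A B : Set

  Σᶠ-zero : ∀ {m} (g : Fin m → Carrier) → (∀ l → g l ≈ 0#) → Σᶠ g ≈ 0#
  Σᶠ-zero {ℕ.zero} g _   = refl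
  Σᶠ-zero {suc m}  g g≈0 = trans (+-cong (g≈0 zero) (Σᶠ-zero (g ∘ suc) (g≈0 ∘ suc))) (+-identityʳ 0#)

  Σᶠ-single : ∀ {m} (g : Fin m → Carrier) (c : Fin m) → (∀ l → l ≢ c → g l ≈ 0#) → Σᶠ g ≈ g c
  Σᶠ-single g zero    off = trans (+-congˡ (Σᶠ-zero (g ∘ suc) (λ l → off (suc l) λ ()))) (+-identityʳ _)
  Σᶠ-single g (suc c) off =
    trans (+-congʳ (off zero λ ()))
          (trans (+-identityˡ _) (Σᶠ-single (g ∘ suc) c (λ l l≢c → off (suc l) (l≢c ∘ suc-injective))))

  sumMap : (A → Carrier) → List A → Carrier
  sumMap h xs = sumL (map h xs)

  sumMap-++ : (h : A → Carrier) (xs ys : List A) → sumMap h (xs ++ ys) ≈ sumMap h xs + sumMap h ys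
  sumMap-++ h []       ys = sym (+-identityˡ _)
  sumMap-++ h (x ∷ xs) ys = trans (+-congˡ (sumMap-++ h xs ys)) (sym (+-assoc _ _ _))

  sumMap-concatMap : (h : B → Carrier) (f : A → List B) (xs : List A) →
                     sumMap h (concatMap f xs) ≈ sumMap (sumMap h ∘ f) xs
  sumMap-concatMap h f []       = refl
  sumMap-concatMap h f (x ∷ xs) = trans (sumMap-++ h (f x) (concatMap f xs)) (+-congˡ (sumMap-concatMap h f xs))

  sumMap-cong : {f g : A → Carrier} {xs : List A} → All (λ x → f x ≈ g x) xs → sumMap f xs ≈ sumMap g xs
  sumMap-cong []             = refl
  sumMap-cong (fx≈gx ∷ rest) = +-cong fx≈gx (sumMap-cong rest)

  sumMap-+ : (f g : A → Carrier) (xs : List A) → sumMap (λ x → f x + g x) xs ≈ sumMap f xs + sumMap g xs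
  sumMap-+ f g []       = sym (+-identityˡ 0#)
  sumMap-+ f g (x ∷ xs) = trans (+-congˡ (sumMap-+ f g xs)) (interchange _ _ _ _)

  sumMap-*ˡ : (a : Carrier) (f : A → Carrier) (xs : List A) → sumMap (λ x → a * f x) xs ≈ a * sumMap f xs
  sumMap-*ˡ a f []       = sym (zeroʳ a)
  sumMap-*ˡ a f (x ∷ xs) = trans (+-congˡ (sumMap-*ˡ a f xs)) (sym (distribˡ _ _ _))

  sumMap-product : (f : A → Carrier) (g : B → Carrier) (xs : List A) (ys : List B) →
                   sumMap (λ x → sumMap (λ y → f x * g y) ys) xs ≈ sumMap f xs * sumMap g ys
  sumMap-product f g []       ys = sym (zeroˡ _)
  sumMap-product f g (x ∷ xs) ys =
    trans (+-cong (sumMap-*ˡ (f x) g ys) (sumMap-product f g xs ys)) (sym (distribʳ _ _ _))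

  Banded : ℕ → Elt → Set ℓ
  Banded w x = ∀ a b k → toℕ b ≢ toℕ a ℕ.+ w → x a b k ≈ 0#

  +ᴱ-banded : ∀ {w x y} → Banded w x → Banded w y → Banded w (x +ᴱ y)
  +ᴱ-banded x-band y-band a b k b≢ = trans (+-cong (x-band a b k b≢) (y-band a b k b≢)) (+-identityʳ 0#)

  ∘ᴬ-banded : ∀ {v w x y} → Banded v x → Banded w y → Banded (v ℕ.+ w) (x ∘ᴬ y)
  ∘ᴬ-banded {v} {w} {x} {y} x-band y-band a b k b≢ with next k
  ... | nothing = refl
  ... | just k′ = Σᶠ-zero _ term≈0
    where
    term≈0 : ∀ l → x a l k′ * y l b k′ ≈ 0#
    term≈0 l with toℕ l ℕ.≟ toℕ a ℕ.+ v
    ... | yes l≡ = trans (*-congˡ (y-band l b k′ λ b≡ →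
                    b≢ (≡.trans b≡ (≡.trans (≡.cong (ℕ._+ w) l≡) (ℕ.+-assoc (toℕ a) v w))))) (zeroʳ _)
    ... | no l≢  = trans (*-congʳ (x-band a l k′ l≢)) (zeroˡ _)

  ⊙-banded : ∀ {v w x y} → Banded v x → Banded w y → Banded (v ℕ.+ w) (x ⊙ y)
  ⊙-banded {v} {w} {x} {y} x-band y-band =
    +ᴱ-banded (∘ᴬ-banded x-band y-band)
              (≡.subst (λ u → Banded u (y ∘ᴬ x)) (ℕ.+-comm w v) (∘ᴬ-banded y-band x-band))

  Zᵢ-banded : ∀ i → Banded 1 (Zᵢ i)
  Zᵢ-banded i a zero    k _ = refl
  Zᵢ-banded i a (suc j) k b≢ with a ≟ inject₁ j
  ... | yes ≡.refl = ⊥-elim (b≢ (≡.trans (≡.cong suc (≡.sym (toℕ-inject₁ j))) (ℕ.+-comm 1 _)))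
  ... | no _       = refl

  Φtree-banded : ∀ t → Banded (leaves t) (Φtree t)
  Φtree-banded (leaf i)   = Zᵢ-banded i
  Φtree-banded (node t u) = ⊙-banded (Φtree-banded t) (Φtree-banded u)

  Σᶠ-through-band : ∀ {v x} → Banded v x → (y : Elt) {a b : Fin (suc d)} (k : Fin d)
                    (c : Fin (suc d)) → toℕ c ≡ toℕ a ℕ.+ v →
                    Σᶠ (λ l → x a l k * y l b k) ≈ x a c k * y c b k
  Σᶠ-through-band {x = x} x-band y {a} {b} k c c≡ = Σᶠ-single (λ l → x a l k * y l b k) c λ l l≢c →
    trans (*-congʳ (x-band _ l k λ l≡ → l≢c (toℕ-injective (≡.trans l≡ (≡.sym c≡))))) (zeroˡ _)

  ∏weight : ℕ → List (Fin n × ℕ) → Carrier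
  ∏weight p o = prodL (weight p o)

  -- φ of a subtree whose leftmost leaf is the p-th leaf and whose root sits at level l;
  -- φtree t is φ-at t 1 1.
  φ-at : Tree n → ℕ → ℕ → Carrier
  φ-at t p l = sumMap (∏weight p) (orientations t l)

  ∏weight-++ : ∀ p o₁ o₂ → ∏weight p (o₁ ++ o₂) ≈ ∏weight p o₁ * ∏weight (p ℕ.+ length o₁) o₂
  ∏weight-++ p [] o₂ rewrite ℕ.+-identityʳ p = sym (*-identityˡ _)
  ∏weight-++ p ((i , l) ∷ o₁) o₂ rewrite ℕ.+-suc p (length o₁) =
    trans (*-congˡ (∏weight-++ (suc p) o₁ o₂)) (sym (*-assoc _ _ _))

  length-orientations : ∀ t l → All (λ o → length o ≡ leaves t) (orientations t l)
  length-orientations (leaf i)   l = ≡.refl ∷ []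
  length-orientations (node t u) l =
    concat⁺ (map⁺ (All.map (λ {o₁} len₁ → concat⁺ (map⁺ (All.map (λ {o₂} len₂ →
        ≡.trans (length-++ o₁) (≡.cong₂ ℕ._+_ len₁ len₂) ∷
        ≡.trans (length-++ o₂) (≡.trans (≡.cong₂ ℕ._+_ len₂ len₁) (ℕ.+-comm (leaves u) (leaves t))) ∷ [])
      (length-orientations u (suc l))))) (length-orientations t (suc l))))

  φ-at-node : ∀ t u p l → φ-at (node t u) p l ≈
    φ-at t p (suc l) * φ-at u (p ℕ.+ leaves t) (suc l) + φ-at u p (suc l) * φ-at t (p ℕ.+ leaves u) (suc l)
  φ-at-node t u p l = begin
      φ-at (node t u) p l
    ≈⟨ sumMap-concatMap (∏weight p) _ Ot ⟩
      sumMap (λ o₁ → sumMap (∏weight p) (concatMap (both o₁) Ou)) Ot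
    ≈⟨ sumMap-cong (All.map split-inner (length-orientations t (suc l))) ⟩
      sumMap (λ o₁ → sumMap (λ o₂ → ∏weight p o₁ * ∏weight (p ℕ.+ leaves t) o₂) Ou
                   + sumMap (λ o₂ → ∏weight (p ℕ.+ leaves u) o₁ * ∏weight p o₂) Ou) Ot
    ≈⟨ trans (sumMap-+ _ _ Ot) (+-cong (sumMap-product _ _ Ot Ou) (sumMap-product _ _ Ot Ou)) ⟩
      φ-at t p (suc l) * φ-at u (p ℕ.+ leaves t) (suc l) + φ-at t (p ℕ.+ leaves u) (suc l) * φ-at u p (suc l)
    ≈⟨ +-congˡ (*-comm _ _) ⟩
      φ-at t p (suc l) * φ-at u (p ℕ.+ leaves t) (suc l) + φ-at u p (suc l) * φ-at t (p ℕ.+ leaves u) (suc l)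
    ∎
    where
    Ot Ou : List (List (Fin n × ℕ))
    Ot = orientations t (suc l)
    Ou = orientations u (suc l)

    both : List (Fin n × ℕ) → List (Fin n × ℕ) → List (List (Fin n × ℕ))
    both o₁ o₂ = (o₁ ++ o₂) ∷ (o₂ ++ o₁) ∷ []

    split-pair : ∀ {o₁ o₂} → length o₁ ≡ leaves t → length o₂ ≡ leaves u →
      sumMap (∏weight p) (both o₁ o₂) ≈
      ∏weight p o₁ * ∏weight (p ℕ.+ leaves t) o₂ + ∏weight (p ℕ.+ leaves u) o₁ * ∏weight p o₂
    split-pair {o₁} {o₂} len₁ len₂ = +-cong
      (trans (∏weight-++ p o₁ o₂) (reflexive (≡.cong (λ q → ∏weight p o₁ * ∏weight (p ℕ.+ q) o₂) len₁)))
      (trans (+-identityʳ _) (trans (∏weight-++ p o₂ o₁)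
        (trans (reflexive (≡.cong (λ q → ∏weight p o₂ * ∏weight (p ℕ.+ q) o₁) len₂)) (*-comm _ _))))

    split-inner : ∀ {o₁} → length o₁ ≡ leaves t →
      sumMap (∏weight p) (concatMap (both o₁) Ou) ≈
      sumMap (λ o₂ → ∏weight p o₁ * ∏weight (p ℕ.+ leaves t) o₂) Ou
        + sumMap (λ o₂ → ∏weight (p ℕ.+ leaves u) o₁ * ∏weight p o₂) Ou
    split-inner {o₁} len₁ =
      trans (sumMap-concatMap _ _ Ou)
            (trans (sumMap-cong (All.map (λ {o₂} → split-pair {o₁} {o₂} len₁) (length-orientations u (suc l))))
                   (sumMap-+ _ _ Ou))

  zℕ-toℕ : ∀ i (j k : Fin d) → zℕ i (suc (toℕ j)) (suc (toℕ k)) ≡ z i j k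
  zℕ-toℕ i j k with toℕ j ℕ.<? d | toℕ k ℕ.<? d
  ... | yes j<d | yes k<d = ≡.cong₂ (z i) (fromℕ<-toℕ j j<d) (fromℕ<-toℕ k k<d)
  ... | yes _   | no k≮d  = ⊥-elim (k≮d (toℕ<n k))
  ... | no j≮d  | _       = ⊥-elim (j≮d (toℕ<n j))

  zℕ-deep : ∀ i p {l} → d ≤ l → zℕ i p (suc l) ≡ 0#
  zℕ-deep i ℕ.zero  _ = ≡.refl
  zℕ-deep i (suc p) {l} d≤l with p ℕ.<? d | l ℕ.<? d
  ... | yes _ | yes l<d = ⊥-elim (ℕ.<⇒≱ l<d d≤l)
  ... | yes _ | no _    = ≡.refl
  ... | no _  | _       = ≡.refl

  φ-at-leaf : ∀ i p l → φ-at (leaf i) p l ≈ zℕ i p l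
  φ-at-leaf i p l = trans (+-identityʳ _) (*-identityʳ _)

  mutual
    φ-at-deep : ∀ t p {l} → d ≤ l → φ-at t p (suc l) ≈ 0#
    φ-at-deep (leaf i)   p d≤l = trans (φ-at-leaf i p _) (reflexive (zℕ-deep i p d≤l))
    φ-at-deep (node t u) p d≤l = φ-at-node-deep t u p (ℕ.m≤n⇒m≤1+n d≤l)

    φ-at-node-deep : ∀ t u p {l} → d ≤ l → φ-at (node t u) p l ≈ 0#
    φ-at-node-deep t u p {l} d≤l =
      trans (φ-at-node t u p l)
            (trans (+-cong (vanish (φ-at-deep t p d≤l)) (vanish (φ-at-deep u p d≤l))) (+-identityʳ 0#))
      where
      vanish : ∀ {x y} → x ≈ 0# → x * y ≈ 0#
      vanish x≈0 = trans (*-congʳ x≈0) (zeroˡ _)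

  Zᵢ-entry : ∀ i a b k → toℕ b ≡ toℕ a ℕ.+ 1 → Zᵢ i a b k ≈ φ-at (leaf i) (suc (toℕ a)) (suc (toℕ k))
  Zᵢ-entry i a zero    k 0≡a+1 = ⊥-elim (ℕ.0≢1+n (≡.trans 0≡a+1 (ℕ.+-comm (toℕ a) 1)))
  Zᵢ-entry i a (suc j) k b≡a+1 with a ≟ inject₁ j
  ... | yes ≡.refl = sym (trans (φ-at-leaf i (suc (toℕ a)) (suc (toℕ k)))
          (reflexive (≡.trans (≡.cong (λ q → zℕ i (suc q) (suc (toℕ k))) (toℕ-inject₁ j)) (zℕ-toℕ i j k))))
  ... | no a≢j = ⊥-elim (a≢j (toℕ-injective
          (≡.trans (ℕ.suc-injective (≡.trans (ℕ.+-comm 1 (toℕ a)) (≡.sym b≡a+1))) (≡.sym (toℕ-inject₁ j)))))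

  EntryFormula : Tree n → Set ℓ
  EntryFormula t = ∀ a b k → toℕ b ≡ toℕ a ℕ.+ leaves t →
                   Φtree t a b k ≈ φ-at t (suc (toℕ a)) (suc (toℕ k))

  Σᶠ-Φtree : ∀ t u → EntryFormula t → EntryFormula u → ∀ a b k →
             toℕ b ≡ toℕ a ℕ.+ (leaves t ℕ.+ leaves u) →
             Σᶠ (λ l → Φtree t a l k * Φtree u l b k) ≈
             φ-at t (suc (toℕ a)) (suc (toℕ k)) * φ-at u (suc (toℕ a) ℕ.+ leaves t) (suc (toℕ k))
  Σᶠ-Φtree t u t-formula u-formula a b k b≡ = begin
      Σᶠ (λ l → Φtree t a l k * Φtree u l b k)
    ≈⟨ Σᶠ-through-band (Φtree-banded t) (Φtree u) k mid mid≡ ⟩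
      Φtree t a mid k * Φtree u mid b k
    ≈⟨ *-cong (t-formula a mid k mid≡) (u-formula mid b k b≡mid+u) ⟩
      φ-at t (suc (toℕ a)) (suc (toℕ k)) * φ-at u (suc (toℕ mid)) (suc (toℕ k))
    ≡⟨ ≡.cong (λ q → φ-at t (suc (toℕ a)) (suc (toℕ k)) * φ-at u (suc q) (suc (toℕ k))) mid≡ ⟩
      φ-at t (suc (toℕ a)) (suc (toℕ k)) * φ-at u (suc (toℕ a) ℕ.+ leaves t) (suc (toℕ k))
    ∎
    where
    b≡a+t+u : toℕ b ≡ toℕ a ℕ.+ leaves t ℕ.+ leaves u
    b≡a+t+u = ≡.trans b≡ (≡.sym (ℕ.+-assoc (toℕ a) (leaves t) (leaves u)))

    a+t<1+d : toℕ a ℕ.+ leaves t < suc d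
    a+t<1+d = ℕ.≤-<-trans (ℕ.m≤m+n _ (leaves u)) (≡.subst (_< suc d) b≡a+t+u (toℕ<n b))

    mid : Fin (suc d)
    mid = fromℕ< a+t<1+d

    mid≡ : toℕ mid ≡ toℕ a ℕ.+ leaves t
    mid≡ = toℕ-fromℕ< a+t<1+d

    b≡mid+u : toℕ b ≡ toℕ mid ℕ.+ leaves u
    b≡mid+u = ≡.trans b≡a+t+u (≡.cong (ℕ._+ leaves u) (≡.sym mid≡))

  Φtree-entry : ∀ t → EntryFormula t
  Φtree-entry (leaf i) = Zᵢ-entry i
  Φtree-entry (node t u) a b k b≡ with next k in eq
  ... | nothing =
    trans (+-identityʳ 0#) (sym (φ-at-node-deep t u _ (ℕ.≤-reflexive (≡.sym (next≡nothing⇒last eq)))))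
  ... | just k′ = begin
      Σᶠ (λ l → Φtree t a l k′ * Φtree u l b k′) + Σᶠ (λ l → Φtree u a l k′ * Φtree t l b k′)
    ≈⟨ +-cong (Σᶠ-Φtree t u (Φtree-entry t) (Φtree-entry u) a b k′ b≡)
              (Σᶠ-Φtree u t (Φtree-entry u) (Φtree-entry t) a b k′
                        (≡.trans b≡ (≡.cong (toℕ a ℕ.+_) (ℕ.+-comm (leaves t) (leaves u))))) ⟩
      φ-at t p (suc (toℕ k′)) * φ-at u (p ℕ.+ leaves t) (suc (toℕ k′))
        + φ-at u p (suc (toℕ k′)) * φ-at t (p ℕ.+ leaves u) (suc (toℕ k′))
    ≈⟨ φ-at-node t u p (toℕ k′) ⟨
      φ-at (node t u) p (toℕ k′)
    ≡⟨ ≡.cong (φ-at (node t u) p) (toℕ-next eq) ⟩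
      φ-at (node t u) p (suc (toℕ k))
    ∎
    where
    p : ℕ
    p = suc (toℕ a)

  Φmono-entry : ∀ m {b : Fin (suc d)} {k : Fin d} → 1 ≤ deg m → toℕ b ≡ deg m → toℕ k ≡ 0 →
                Φmono m zero b k ≈ φmono m
  Φmono-entry 𝟙     ()
  Φmono-entry ⌜ t ⌝ {b} {k} _ b≡ k≡0 =
    trans (Φtree-entry t zero b k b≡) (reflexive (≡.cong (λ q → φ-at t 1 (suc q)) k≡0))

  Φ-entry≈φ : ∀ {a} {A : Set a} (ι : A → Carrier) {i j k} (f : Poly A n) →
              All (λ term → Φmono (proj₂ term) i j k ≈ φmono (proj₂ term)) f → Φ ι f i j k ≈ φ ι f
  Φ-entry≈φ ι []            []       = refl
  Φ-entry≈φ ι ((_ , _) ∷ f) (e ∷ es) = +-cong (*-congˡ e) (Φ-entry≈φ ι f es)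

mainTheorem10 : ∀ {c₁ ℓ₁ c₂ ℓ₂ : Level}
    (F : CommutativeRing c₁ ℓ₁) → IsField F →
    (K : CommutativeRing c₂ ℓ₂) (ι : CommutativeRing.Carrier F → CommutativeRing.Carrier K) →
    IsRingHomomorphism (CommutativeRing.rawRing F) (CommutativeRing.rawRing K) ι →
    (n d : ℕ) (1≤d : 1 ≤ d)
    (z : Fin n → Fin d → Fin d → CommutativeRing.Carrier K)
    (d′ : ℕ) (1≤d′ : 1 ≤ d′) (d′≤d : d′ ≤ d)
    (f : Poly (CommutativeRing.Carrier F) n) → IsHomogeneous d′ f →
    CommutativeRing._≈_ K
      (Construction.Φ K n d z ι f zero (fromℕ< (s≤s d′≤d)) (fromℕ< 1≤d))
      (Construction.φ K n d z ι (component d′ f))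
mainTheorem10 F _ K ι _ n d 1≤d z d′ 1≤d′ d′≤d f homogeneous = begin
    Φ ι f zero b k₀        ≈⟨ Φ-entry≈φ ι f (All.map (λ {term} → monomial-entry {term}) homogeneous) ⟩
    φ ι f                  ≡⟨ ≡.cong (φ ι) (filter-all (λ term → deg (proj₂ term) ℕ.≟ d′) homogeneous) ⟨
    φ ι (component d′ f)   ∎
  where
  open CommutativeRing K using (_≈_; setoid)
  open import Relation.Binary.Reasoning.Setoid setoid
  open Construction K n d z using (Φ; φ; Φmono; φmono)
  open Entries K n d z using (Φmono-entry; Φ-entry≈φ)

  b : Fin (suc d)
  b = fromℕ< (s≤s d′≤d)

  k₀ : Fin d
  k₀ = fromℕ< 1≤d

  monomial-entry : ∀ {term} → deg (proj₂ term) ≡ d′ → Φmono (proj₂ term) zero b k₀ ≈ φmono (proj₂ term)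
  monomial-entry {_ , m} deg≡d′ =
    Φmono-entry m (≡.subst (1 ≤_) (≡.sym deg≡d′) 1≤d′)
                  (≡.trans (toℕ-fromℕ< (s≤s d′≤d)) (≡.sym deg≡d′)) (toℕ-fromℕ< 1≤d)
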